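{- Let $K$ be a semifield and $P$ a polygon. Let $d_1,\dots,d_m$ be pairwise non-crossing internal diagonals of $P$ dividing $P$ into subpolygons $P_1,\dots,P_{m+1}$, let $D_i$ be a dissection of $P_i$ for each $i$, and let $D = \{d_1,\dots,d_m\} \sqcup D_1 \sqcup \cdots \sqcup D_{m+1}$. Let $f_i : \operatorname{diag}(P_i) \to K$ be a weak frieze with respect to $D_i$ for each $i$, such that whenever $P_i$ and $P_j$ share a diagonal $d$, $f_i(d) = f_j(d)$, and let $f:\operatorname{diag}(P)\to K$ be the unique weak frieze with respect to $D$ with $f|_{\operatorname{diag}(P_i)} = f_i$ for each $i$. Then $f$ is a frieze if and only if each $f_i$ is a frieze.
   Context: A semifield is a set $K$ with binary operations $+$ and $\cdot$ such that $+$ is associative and commutative, $(K,\cdot)$ is a commutative group with unit $1_K$, and $\cdot$ distributes over $+$. A polygon $P$ is a finite set $V$ of at least three vertices with a cyclic order. A subpolygon is a subset of $V$ with at least three vertices and the induced cyclic order. A diagonal is a two-element subset $\{\alpha,\beta\}$ of the vertex set; $\operatorname{diag}(P)$ is the set of diagonals; write $f(\alpha,\beta):=f(\{\alpha,\beta\})$. Edges are diagonals $\{\alpha,\alpha^+\}$ with $\alpha^+$ the successor of $\alpha$; others are internal. Diagonals $\{\alpha,\beta\}$, $\{\gamma,\delta\}$ cross if $\alpha,\beta,\gamma,\delta$ are four distinct vertices appearing in the cyclic order as $\alpha,\gamma,\beta,\delta$ or $\alpha,\delta,\beta,\gamma$. A dissection is a (possibly empty) set of pairwise non-crossing internal diagonals.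 A map $f:\operatorname{diag}(P)\to K$ is a frieze if $f(\alpha,\beta)f(\gamma,\delta) = f(\alpha,\gamma)f(\beta,\delta) + f(\alpha,\delta)f(\beta,\gamma)$ for all crossing diagonals $\{\alpha,\beta\}$, $\{\gamma,\delta\}$; it is a weak frieze with respect to a dissection $D$ if this relation holds whenever $\{\alpha,\beta\}$ and $\{\gamma,\delta\}$ cross and $\{\gamma,\delta\}\in D$. (Existence and uniqueness of such an $f$ is part of the setting.) -}

module Defs where

open import Level using (Level)
open import Data.Nat using (ℕ; suc; _≤_)
open import Data.Fin using (Fin; _<_)
open import Data.Fin.Properties using (<-cmp)
open import Data.Fin.Subset using (Subset; _∈_; ∣_∣)
import Data.Fin.Subset
open import Data.Product using (Σ; _×_; _,_)
open import Data.Sum using (_⊎_)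
open import Data.Empty using (⊥)
open import Relation.Nullary using (¬_)
open import Relation.Binary using (Tri; tri<; tri≈; tri>)
open import Relation.Binary.PropositionalEquality using (_≡_)
open import Algebra.Structures using (IsAbelianGroup; IsCommutativeSemigroup)
open import Algebra.Definitions using (_DistributesOverˡ_)

record Semifield : Set₁ where
  infixl 7 _*_
  infixl 6 _+_
  field
    Carrier : Set
    _+_     : Carrier → Carrier → Carrier
    _*_     : Carrier → Carrier → Carrier
    1#      : Carrier
    _⁻¹     : Carrier → Carrier
    +-isCommutativeSemigroup : IsCommutativeSemigroup _≡_ _+_
    *-isAbelianGroup         : IsAbelianGroup _≡_ _*_ 1# _⁻¹
    distrib                  : _DistributesOverˡ_ _≡_ _*_ _+_

-- The polygon P is the vertex set Fin n with its standard cyclic order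
-- 0 → 1 → … → n-1 → 0.  A diagonal {a,b} is stored with a < b.

record Diag (n : ℕ) : Set where
  constructor diag
  field
    lo   : Fin n
    hi   : Fin n
    lo<hi : lo < hi

open Diag public

-- Apply a function on diagonals to an (unordered) pair of vertices:
-- g {a,b}.  The value for a ≡ b is never used (it only occurs for
-- distinct vertices below).
onPair : ∀ {ℓ} {n} {A : Set ℓ} → A → (Diag n → A) → Fin n → Fin n → A
onPair {A = A} dflt g a b with <-cmp a b
... | tri< a<b _ _ = g (diag a b a<b)
... | tri≈ _ _ _   = dflt
... | tri> _ _ b<a = g (diag b a b<a)

Cyc4 : ∀ {n} → Fin n → Fin n → Fin n → Fin n → Set
Cyc4 a b c d =
    (a < b × b < c × c < d)
  ⊎ (b < c × c < d × d < a)
  ⊎ (c < d × d < a × a < b)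
  ⊎ (d < a × a < b × b < c)

Cross : ∀ {n} → Fin n → Fin n → Fin n → Fin n → Set
Cross a b c d = Cyc4 a c b d ⊎ Cyc4 a d b c

CrossD : ∀ {n} → Diag n → Diag n → Set
CrossD d e = Cross (lo d) (hi d) (lo e) (hi e)

-- Subpolygons (subsets of the vertices, induced cyclic order)

Subpolygon : ∀ {n} → Subset n → Set
Subpolygon S = 3 ≤ ∣ S ∣

InDiag : ∀ {n} → Subset n → Diag n → Set
InDiag S d = lo d ∈ S × hi d ∈ S

-- d is an edge of S: its endpoints are consecutive in the induced cyclic order
IsEdgeOf : ∀ {n} → Subset n → Diag n → Set
IsEdgeOf S d =
    (∀ c → c ∈ S → ¬ (lo d < c × c < hi d))
  ⊎ (∀ c → c ∈ S → ¬ (c < lo d) × ¬ (hi d < c))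

IsInternalOf : ∀ {n} → Subset n → Diag n → Set
IsInternalOf S d = InDiag S d × ¬ IsEdgeOf S d

DiagSet : ℕ → Set₁
DiagSet n = Diag n → Set

_∈D_ : ∀ {n} → Fin n × Fin n → DiagSet n → Set
(a , b) ∈D D = onPair ⊥ D a b

IsDissectionOf : ∀ {n} → Subset n → DiagSet n → Set
IsDissectionOf S D =
  (∀ d → D d → IsInternalOf S d) × (∀ d e → D d → D e → ¬ CrossD d e)

-- S is one of the subpolygons into which the non-crossing internal
-- diagonals E divide P: the edges of S are edges of P or elements of E,
-- and no element of E lies inside S.
IsCellOf : ∀ {n} → DiagSet n → Subset n → Set
IsCellOf E S =
    Subpolygon S
  × (∀ d → InDiag S d → IsEdgeOf S d → IsEdgeOf Data.Fin.Subset.⊤ d ⊎ E d)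
  × (∀ d → IsInternalOf S d → ¬ E d)

-- Friezes on a subpolygon S (maps are Diag n → K; only values on
-- diag(S) matter)

module _ (K : Semifield) where
  open Semifield K

  _⟨_,_⟩ : ∀ {n} → (Diag n → Carrier) → Fin n → Fin n → Carrier
  f ⟨ a , b ⟩ = onPair 1# f a b

  PtolemyAt : ∀ {n} → (Diag n → Carrier) → Fin n → Fin n → Fin n → Fin n → Set
  PtolemyAt f α β γ δ =
    f ⟨ α , β ⟩ * f ⟨ γ , δ ⟩ ≡ f ⟨ α , γ ⟩ * f ⟨ β , δ ⟩ + f ⟨ α , δ ⟩ * f ⟨ β , γ ⟩

  IsFriezeOn : ∀ {n} → Subset n → (Diag n → Carrier) → Set
  IsFriezeOn S f = ∀ α β γ δ → α ∈ S → β ∈ S → γ ∈ S → δ ∈ S →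
    Cross α β γ δ → PtolemyAt f α β γ δ

  IsWeakFriezeOn : ∀ {n} → Subset n → DiagSet n → (Diag n → Carrier) → Set
  IsWeakFriezeOn S D f = ∀ α β γ δ → α ∈ S → β ∈ S → γ ∈ S → δ ∈ S →
    Cross α β γ δ → (γ , δ) ∈D D → PtolemyAt f α β γ δ

-- Write F a b for f({a,b}); f is a frieze iff F satisfies the Ptolemy relation
-- F a c · F b d = F a b · F c d + F a d · F b c for every cyclically ordered
-- quadruple a b c d. Since multiplication in a semifield cancels, three of the
-- Ptolemy relations among the vertices of a pentagon imply a fourth, and with
-- this one glues: if F satisfies every relation across a diagonal {p,q} and
-- every relation among vertices on one side of it, then it satisfies all
-- relations. Restricting a frieze gives friezes on the P_i. Conversely, induct
-- on the number of d_k that separate two vertices of a quadruple. If some d_k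
-- does, glue along it: the weak-frieze condition for d_k ∈ D gives the
-- relations across d_k, and a quadruple taken from the old vertices and the
-- ends of d_k lying on one side of d_k is separated by strictly fewer
-- diagonals. If none does, the vertices separated from the quadruple by no d_k
-- form a cell, i.e. some P_i, where f agrees with the frieze f_i.

module Submission where

open import Defs
open import Level using (Level)
open import Algebra.Bundles using (CommutativeMonoid)
open import Algebra.Structures using (IsCommutativeSemigroup; IsAbelianGroup)
import Algebra.Solver.CommutativeMonoid as CMSolver
open import Data.Nat.Base as ℕ using (ℕ; suc; z≤n; s≤s; _∸_; _≤_)
import Data.Nat.Properties as ℕ
open import Data.Fin.Base as Fin using (Fin; _<_; toℕ; fromℕ)
open import Data.Fin.Properties
  using (<-trans; <-asym; <-cmp; <-irrefl; <-irrelevant; ≤-antisym; _≟_; _<?_; _≤?_; ≤fromℕ; any?; all?)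
open import Data.Fin.Subset using (Subset; ⊤; _∈_; _∉_; _⊂_; ∣_∣; _-_)
open import Data.Fin.Subset.Properties
  using (∈⊤; p⊂q⇒∣p∣<∣q∣; x∈p⇒∣p-x∣<∣p∣; x∈p∧x∉q⇒x∈p─q; x≢y⇒x∉⁅y⁆)
open import Data.Vec.Base using (tabulate)
open import Data.Vec.Properties using (lookup∘tabulate; []=⇒lookup; lookup⇒[]=)
open import Data.List.Base using (filter; allFin)
open import Data.List.Extrema.Nat using (argmax; argmin; argmax-all; argmin-all; f[xs]≤f[argmax]; f[argmin]≤f[xs])
open import Data.List.Relation.Unary.All as All using ()
open import Data.List.Relation.Unary.All.Properties using (all-filter)
open import Data.List.Membership.Propositional.Properties using (∈-filter⁺; ∈-allFin)
open import Data.Product.Base using (Σ; ∃; _×_; _,_; proj₁; proj₂)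
open import Data.Sum.Base using (_⊎_; inj₁; inj₂; swap)
open import Data.Empty using (⊥; ⊥-elim)
open import Relation.Nullary using (¬_; Dec; yes; no; does)
open import Relation.Nullary.Decidable using (_×-dec_; _⊎-dec_; ¬?; dec-true)
open import Relation.Binary using (tri<; tri≈; tri>)
open import Relation.Binary.PropositionalEquality
open import Function.Base using (_∘_; _∘′_)
open import Function.Definitions using (Injective)
open import Function.Bundles using (_⇔_; mk⇔)

private variable
  ℓ : Level
  n m : ℕ
  T : Set ℓ
  a b c d e p q : Fin n

-- Semifields and Ptolemy relations

module SemifieldProperties (K : Semifield) where
  open Semifield K
  open IsCommutativeSemigroup +-isCommutativeSemigroup public
    using () renaming (assoc to +-assoc; comm to +-comm)
  open IsAbelianGroup *-isAbelianGroup public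
    using () renaming (assoc to *-assoc; comm to *-comm; identityʳ to *-identityʳ; inverseʳ to *-inverseʳ;
                       isCommutativeMonoid to *-isCommutativeMonoid)
  open ≡-Reasoning

  *-commutativeMonoid : CommutativeMonoid _ _
  *-commutativeMonoid = record { isCommutativeMonoid = *-isCommutativeMonoid }

  module *-Solver = CMSolver *-commutativeMonoid

  *-distribʳ-+ : ∀ x y z → (y + z) * x ≡ y * x + z * x
  *-distribʳ-+ x y z = begin
    (y + z) * x    ≡⟨ *-comm (y + z) x ⟩
    x * (y + z)    ≡⟨ distrib x y z ⟩
    x * y + x * z  ≡⟨ cong₂ _+_ (*-comm x y) (*-comm x z) ⟩
    y * x + z * x  ∎

  *-cancelʳ : ∀ {a b} c → a * c ≡ b * c → a ≡ b
  *-cancelʳ {a} {b} c eq = begin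
    a                ≡⟨ sym (*-identityʳ a) ⟩
    a * 1#           ≡⟨ cong (a *_) (sym (*-inverseʳ c)) ⟩
    a * (c * c ⁻¹)   ≡⟨ sym (*-assoc a c (c ⁻¹)) ⟩
    (a * c) * c ⁻¹   ≡⟨ cong (_* c ⁻¹) eq ⟩
    (b * c) * c ⁻¹   ≡⟨ *-assoc b c (c ⁻¹) ⟩
    b * (c * c ⁻¹)   ≡⟨ cong (b *_) (*-inverseʳ c) ⟩
    b * 1#           ≡⟨ *-identityʳ b ⟩
    b                ∎

  +-exchange : ∀ x y z → x + (y + z) ≡ y + (x + z)
  +-exchange x y z = begin
    x + (y + z)  ≡⟨ sym (+-assoc x y z) ⟩
    (x + y) + z  ≡⟨ cong (_+ z) (+-comm x y) ⟩
    (y + x) + z  ≡⟨ +-assoc y x z ⟩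
    y + (x + z)  ∎

module PtolemyRelations (K : Semifield) {V : Set} (F : V → V → Semifield.Carrier K)
                        (F-sym : ∀ a b → F a b ≡ F b a) where
  open Semifield K
  open SemifieldProperties K
  open ≡-Reasoning

  Ptolemy : V → V → V → V → Set
  Ptolemy a b c d = F a c * F b d ≡ F a b * F c d + F a d * F b c

  -- Multiplying by F a c * F a d, both sides expand to the same four products.
  ptolemy-pentagon : ∀ {a b c d e} →
    Ptolemy a b c e → Ptolemy a c d e → Ptolemy a b c d → Ptolemy b c d e
  ptolemy-pentagon {a} {b} {c} {d} {e} abce acde abcd =
    *-cancelʳ (F a c * F a d) (trans lhs (sym rhs))
    where
    open *-Solver using (solve; _⊕_; _⊜_)
    ac = F a c ; ad = F a d ; ab = F a b ; ae = F a e ; bc = F b c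
    bd = F b d ; be = F b e ; cd = F c d ; ce = F c e ; de = F d e
    A = (ab * cd) * (ac * de)
    B = (ab * cd) * (ae * cd)
    C = (ad * bc) * (ac * de)
    D = (ad * bc) * (ae * cd)

    lhs : (bd * ce) * (ac * ad) ≡ (A + B) + (C + D)
    lhs = begin
      (bd * ce) * (ac * ad)
        ≡⟨ solve 4 (λ bd ce ac ad → (bd ⊕ ce) ⊕ (ac ⊕ ad) ⊜ (ac ⊕ bd) ⊕ (ad ⊕ ce)) refl bd ce ac ad ⟩
      (ac * bd) * (ad * ce)
        ≡⟨ cong₂ _*_ abcd acde ⟩
      (ab * cd + ad * bc) * (ac * de + ae * cd)
        ≡⟨ *-distribʳ-+ _ _ _ ⟩
      (ab * cd) * (ac * de + ae * cd) + (ad * bc) * (ac * de + ae * cd)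
        ≡⟨ cong₂ _+_ (distrib _ _ _) (distrib _ _ _) ⟩
      (A + B) + (C + D) ∎

    rhs : (bc * de + be * cd) * (ac * ad) ≡ (A + B) + (C + D)
    rhs = begin
      (bc * de + be * cd) * (ac * ad)
        ≡⟨ *-distribʳ-+ _ _ _ ⟩
      (bc * de) * (ac * ad) + (be * cd) * (ac * ad)
        ≡⟨ cong₂ _+_
             (solve 4 (λ bc de ac ad → (bc ⊕ de) ⊕ (ac ⊕ ad) ⊜ (ad ⊕ bc) ⊕ (ac ⊕ de)) refl bc de ac ad)
             (solve 4 (λ be cd ac ad → (be ⊕ cd) ⊕ (ac ⊕ ad) ⊜ (ac ⊕ be) ⊕ (cd ⊕ ad)) refl be cd ac ad) ⟩
      C + (ac * be) * (cd * ad)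
        ≡⟨ cong (λ t → C + t * (cd * ad)) abce ⟩
      C + (ab * ce + ae * bc) * (cd * ad)
        ≡⟨ cong (C +_) (*-distribʳ-+ _ _ _) ⟩
      C + ((ab * ce) * (cd * ad) + (ae * bc) * (cd * ad))
        ≡⟨ cong₂ (λ s t → C + (s + t))
             (solve 4 (λ ab ce cd ad → (ab ⊕ ce) ⊕ (cd ⊕ ad) ⊜ (ab ⊕ cd) ⊕ (ad ⊕ ce)) refl ab ce cd ad)
             (solve 4 (λ ae bc cd ad → (ae ⊕ bc) ⊕ (cd ⊕ ad) ⊜ (ad ⊕ bc) ⊕ (ae ⊕ cd)) refl ae bc cd ad) ⟩
      C + ((ab * cd) * (ad * ce) + D)
        ≡⟨ cong (λ t → C + ((ab * cd) * t + D)) acde ⟩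
      C + ((ab * cd) * (ac * de + ae * cd) + D)
        ≡⟨ cong (λ t → C + (t + D)) (distrib _ _ _) ⟩
      C + ((A + B) + D)
        ≡⟨ +-exchange C (A + B) D ⟩
      (A + B) + (C + D) ∎

  ptolemy-rotate : ∀ {a b c d} → Ptolemy a b c d → Ptolemy b c d a
  ptolemy-rotate {a} {b} {c} {d} abcd = begin
    F b d * F c a                  ≡⟨ *-comm (F b d) (F c a) ⟩
    F c a * F b d                  ≡⟨ cong (_* F b d) (F-sym c a) ⟩
    F a c * F b d                  ≡⟨ abcd ⟩
    F a b * F c d + F a d * F b c  ≡⟨ +-comm _ _ ⟩
    F a d * F b c + F a b * F c d  ≡⟨ cong₂ _+_ (*-comm (F a d) (F b c)) (cong (_* F c d) (F-sym a b)) ⟩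
    F b c * F a d + F b a * F c d  ≡⟨ cong (λ t → F b c * t + F b a * F c d) (F-sym a d) ⟩
    F b c * F d a + F b a * F c d  ∎

  ptolemy-rotate² : ∀ {a b c d} → Ptolemy a b c d → Ptolemy c d a b
  ptolemy-rotate² = ptolemy-rotate ∘′ ptolemy-rotate

  ptolemy-rotate⁻¹ : ∀ {a b c d} → Ptolemy b c d a → Ptolemy a b c d
  ptolemy-rotate⁻¹ = ptolemy-rotate ∘′ ptolemy-rotate²

  ptolemy-reverse : ∀ {a b c d} → Ptolemy a b c d → Ptolemy d c b a
  ptolemy-reverse {a} {b} {c} {d} abcd = begin
    F d b * F c a                  ≡⟨ cong₂ _*_ (F-sym d b) (F-sym c a) ⟩
    F b d * F a c                  ≡⟨ *-comm (F b d) (F a c) ⟩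
    F a c * F b d                  ≡⟨ abcd ⟩
    F a b * F c d + F a d * F b c  ≡⟨ cong₂ _+_ (*-comm (F a b) (F c d)) (cong (_* F b c) (F-sym a d)) ⟩
    F c d * F a b + F d a * F b c  ≡⟨ cong₂ _+_ (cong₂ _*_ (F-sym c d) (F-sym a b)) (cong (F d a *_) (F-sym b c)) ⟩
    F d c * F b a + F d a * F c b  ∎

  ptolemy-pentagon′ : ∀ {a b c d e} →
    Ptolemy a b d e → Ptolemy a b c d → Ptolemy a c d e → Ptolemy b c d e
  ptolemy-pentagon′ abde abcd acde = ptolemy-reverse
    (ptolemy-pentagon (ptolemy-reverse (ptolemy-rotate abde)) (ptolemy-reverse (ptolemy-rotate abcd))
                      (ptolemy-reverse (ptolemy-rotate acde)))

-- Cyclic order of the vertices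

-- a, b, c appear (distinct) in this cyclic order; equivalently b precedes c
-- in the linear order on the vertices that starts at a.
Cyc3 : Fin n → Fin n → Fin n → Set
Cyc3 a b c = (a < b × b < c) ⊎ (b < c × c < a) ⊎ (c < a × a < b)

cyc3? : (a b c : Fin n) → Dec (Cyc3 a b c)
cyc3? a b c = ((a <? b) ×-dec (b <? c)) ⊎-dec ((b <? c) ×-dec (c <? a)) ⊎-dec ((c <? a) ×-dec (a <? b))

cyc3-rotate : Cyc3 a b c → Cyc3 b c a
cyc3-rotate (inj₁ x)        = inj₂ (inj₂ x)
cyc3-rotate (inj₂ (inj₁ x)) = inj₁ x
cyc3-rotate (inj₂ (inj₂ x)) = inj₂ (inj₁ x)

cyc3-rotate⁻¹ : Cyc3 a b c → Cyc3 c a b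
cyc3-rotate⁻¹ = cyc3-rotate ∘ cyc3-rotate

cyc3-asym : Cyc3 a b c → ¬ Cyc3 a c b
cyc3-asym (inj₁ (_ , bc))        (inj₁ (_ , cb))        = <-asym bc cb
cyc3-asym (inj₁ (_ , bc))        (inj₂ (inj₁ (cb , _))) = <-asym bc cb
cyc3-asym (inj₁ (ab , _))        (inj₂ (inj₂ (ba , _))) = <-asym ab ba
cyc3-asym (inj₂ (inj₁ (bc , _))) (inj₁ (_ , cb))        = <-asym bc cb
cyc3-asym (inj₂ (inj₁ (bc , _))) (inj₂ (inj₁ (cb , _))) = <-asym bc cb
cyc3-asym (inj₂ (inj₁ (_ , ca))) (inj₂ (inj₂ (_ , ac))) = <-asym ca ac
cyc3-asym (inj₂ (inj₂ (ca , _))) (inj₁ (ac , _))        = <-asym ca ac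
cyc3-asym (inj₂ (inj₂ (_ , ab))) (inj₂ (inj₁ (_ , ba))) = <-asym ab ba
cyc3-asym (inj₂ (inj₂ (_ , ab))) (inj₂ (inj₂ (ba , _))) = <-asym ab ba

cyc3⇒≢₁₂ : Cyc3 a b c → a ≢ b
cyc3⇒≢₁₂ abc refl = cyc3-asym (cyc3-rotate⁻¹ abc) (cyc3-rotate⁻¹ abc)

cyc3⇒≢₂₃ : Cyc3 a b c → b ≢ c
cyc3⇒≢₂₃ abc refl = cyc3-asym abc abc

cyc3⇒≢₁₃ : Cyc3 a b c → a ≢ c
cyc3⇒≢₁₃ abc refl = cyc3-asym (cyc3-rotate abc) (cyc3-rotate abc)

cyc3-trans : Cyc3 a b c → Cyc3 a c d → Cyc3 a b d
cyc3-trans (inj₁ (ab , bc))        (inj₁ (_ , cd))        = inj₁ (ab , <-trans bc cd)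
cyc3-trans (inj₁ (ab , bc))        (inj₂ (inj₁ (cd , da))) = ⊥-elim (<-asym ab (<-trans (<-trans bc cd) da))
cyc3-trans (inj₁ (ab , _))         (inj₂ (inj₂ (da , _))) = inj₂ (inj₂ (da , ab))
cyc3-trans (inj₂ (inj₁ (_ , ca)))  (inj₁ (ac , _))        = ⊥-elim (<-asym ca ac)
cyc3-trans (inj₂ (inj₁ (bc , _)))  (inj₂ (inj₁ (cd , da))) = inj₂ (inj₁ (<-trans bc cd , da))
cyc3-trans (inj₂ (inj₁ (_ , ca)))  (inj₂ (inj₂ (_ , ac))) = ⊥-elim (<-asym ca ac)
cyc3-trans (inj₂ (inj₂ (ca , _)))  (inj₁ (ac , _))        = ⊥-elim (<-asym ca ac)
cyc3-trans (inj₂ (inj₂ (_ , ab)))  (inj₂ (inj₁ (_ , da))) = inj₂ (inj₂ (da , ab))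
cyc3-trans (inj₂ (inj₂ (ca , _)))  (inj₂ (inj₂ (_ , ac))) = ⊥-elim (<-asym ca ac)

-- Moving the starting point of the linear order from a to b.
cyc3-recut : Cyc3 a b c → Cyc3 a c d → Cyc3 b c d
cyc3-recut (inj₁ (_ , bc))         (inj₁ (_ , cd))         = inj₁ (bc , cd)
cyc3-recut (inj₁ (_ , bc))         (inj₂ (inj₁ (cd , _)))  = inj₁ (bc , cd)
cyc3-recut (inj₁ (ab , bc))        (inj₂ (inj₂ (da , _)))  = inj₂ (inj₂ (<-trans da ab , bc))
cyc3-recut (inj₂ (inj₁ (_ , ca)))  (inj₁ (ac , _))         = ⊥-elim (<-asym ca ac)
cyc3-recut (inj₂ (inj₁ (bc , _)))  (inj₂ (inj₁ (cd , _)))  = inj₁ (bc , cd)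
cyc3-recut (inj₂ (inj₁ (_ , ca)))  (inj₂ (inj₂ (_ , ac)))  = ⊥-elim (<-asym ca ac)
cyc3-recut (inj₂ (inj₂ (ca , _)))  (inj₁ (ac , _))         = ⊥-elim (<-asym ca ac)
cyc3-recut (inj₂ (inj₂ (_ , ab)))  (inj₂ (inj₁ (cd , da))) = inj₂ (inj₁ (cd , <-trans da ab))
cyc3-recut (inj₂ (inj₂ (ca , _)))  (inj₂ (inj₂ (_ , ac)))  = ⊥-elim (<-asym ca ac)

cyc3-total : a ≢ b → b ≢ c → a ≢ c → Cyc3 a b c ⊎ Cyc3 a c b
cyc3-total {a = a} {b} {c} a≢b b≢c a≢c with <-cmp a b | <-cmp b c | <-cmp a c
... | tri≈ _ a≡b _ | _            | _            = ⊥-elim (a≢b a≡b)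
... | _            | tri≈ _ b≡c _ | _            = ⊥-elim (b≢c b≡c)
... | _            | _            | tri≈ _ a≡c _ = ⊥-elim (a≢c a≡c)
... | tri< ab _ _  | tri< bc _ _  | _            = inj₁ (inj₁ (ab , bc))
... | tri< _ _ _   | tri> _ _ cb  | tri< ac _ _  = inj₂ (inj₁ (ac , cb))
... | tri< ab _ _  | tri> _ _ _   | tri> _ _ ca  = inj₁ (inj₂ (inj₂ (ca , ab)))
... | tri> _ _ ba  | tri< _ _ _   | tri< ac _ _  = inj₂ (inj₂ (inj₂ (ba , ac)))
... | tri> _ _ _   | tri< bc _ _  | tri> _ _ ca  = inj₁ (inj₂ (inj₁ (bc , ca)))
... | tri> _ _ ba  | tri> _ _ cb  | _            = inj₂ (inj₂ (inj₁ (cb , ba)))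

record CycQuad (a b c d : Fin n) : Set where
  constructor cycQuad′
  field
    abc : Cyc3 a b c
    abd : Cyc3 a b d
    acd : Cyc3 a c d
    bcd : Cyc3 b c d

cycQuad : Cyc3 a b c → Cyc3 a c d → CycQuad a b c d
cycQuad abc acd = cycQuad′ abc (cyc3-trans abc acd) acd (cyc3-recut abc acd)

cycQuad-rotate : CycQuad a b c d → CycQuad b c d a
cycQuad-rotate (cycQuad′ abc abd acd bcd) = cycQuad′ bcd (cyc3-rotate abc) (cyc3-rotate abd) (cyc3-rotate acd)

cycQuad⇒Cyc4 : CycQuad a b c d → Cyc4 a b c d
cycQuad⇒Cyc4 q = go (CycQuad.abc q) (CycQuad.acd q)
  where
  go : Cyc3 a b c → Cyc3 a c d → Cyc4 a b c d
  go (inj₁ (ab , bc))        (inj₁ (_ , cd))         = inj₁ (ab , bc , cd)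
  go (inj₁ (ab , bc))        (inj₂ (inj₁ (cd , da))) = ⊥-elim (<-asym ab (<-trans (<-trans bc cd) da))
  go (inj₁ (ab , bc))        (inj₂ (inj₂ (da , _)))  = inj₂ (inj₂ (inj₂ (da , ab , bc)))
  go (inj₂ (inj₁ (_ , ca)))  (inj₁ (ac , _))         = ⊥-elim (<-asym ca ac)
  go (inj₂ (inj₁ (bc , _)))  (inj₂ (inj₁ (cd , da))) = inj₂ (inj₁ (bc , cd , da))
  go (inj₂ (inj₁ (_ , ca)))  (inj₂ (inj₂ (_ , ac)))  = ⊥-elim (<-asym ca ac)
  go (inj₂ (inj₂ (ca , _)))  (inj₁ (ac , _))         = ⊥-elim (<-asym ca ac)
  go (inj₂ (inj₂ (_ , ab)))  (inj₂ (inj₁ (cd , da))) = inj₂ (inj₂ (inj₁ (cd , da , ab)))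
  go (inj₂ (inj₂ (ca , _)))  (inj₂ (inj₂ (_ , ac)))  = ⊥-elim (<-asym ca ac)

Cyc4⇒cycQuad : Cyc4 a b c d → CycQuad a b c d
Cyc4⇒cycQuad (inj₁ (ab , bc , cd))               = cycQuad (inj₁ (ab , bc)) (inj₁ (<-trans ab bc , cd))
Cyc4⇒cycQuad (inj₂ (inj₁ (bc , cd , da)))        = cycQuad (inj₂ (inj₁ (bc , <-trans cd da))) (inj₂ (inj₁ (cd , da)))
Cyc4⇒cycQuad (inj₂ (inj₂ (inj₁ (cd , da , ab)))) = cycQuad (inj₂ (inj₂ (<-trans cd da , ab))) (inj₂ (inj₁ (cd , da)))
Cyc4⇒cycQuad (inj₂ (inj₂ (inj₂ (da , ab , bc)))) = cycQuad (inj₁ (ab , bc)) (inj₂ (inj₂ (da , <-trans ab bc)))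

record CycPent (a b c d e : Fin n) : Set where
  constructor cycPent′
  field
    abc : Cyc3 a b c
    abd : Cyc3 a b d
    abe : Cyc3 a b e
    acd : Cyc3 a c d
    ace : Cyc3 a c e
    ade : Cyc3 a d e
    bcd : Cyc3 b c d
    bce : Cyc3 b c e
    bde : Cyc3 b d e
    cde : Cyc3 c d e

cycPent : CycQuad a b c d → Cyc3 d e a → CycPent a b c d e
cycPent (cycQuad′ abc abd acd bcd) dea =
  cycPent′ abc abd (cyc3-trans abd ade) acd (cyc3-trans acd ade) ade bcd (cyc3-trans bcd bde) bde (cyc3-recut acd ade)
  where
  ade = cyc3-rotate⁻¹ dea
  bde = cyc3-recut abd ade

module _ (π : CycPent a b c d e) where
  open CycPent π

  cycPent-drop₁ : CycQuad b c d e
  cycPent-drop₁ = cycQuad′ bcd bce bde cde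

  cycPent-drop₂ : CycQuad a c d e
  cycPent-drop₂ = cycQuad′ acd ace ade cde

  cycPent-drop₄ : CycQuad a b c e
  cycPent-drop₄ = cycQuad′ abc abe ace bce

  cycPent-drop₅ : CycQuad a b c d
  cycPent-drop₅ = cycQuad′ abc abd acd bcd

  cycPent-rotate : CycPent b c d e a
  cycPent-rotate = cycPent cycPent-drop₁ (cyc3-rotate⁻¹ abe)

Quad : Fin n → Fin n → Fin n → Fin n → Fin n → Set
Quad a b c d v = v ≡ a ⊎ v ≡ b ⊎ v ≡ c ⊎ v ≡ d

quad? : (a b c d v : Fin n) → Dec (Quad a b c d v)
quad? a b c d v = (v ≟ a) ⊎-dec (v ≟ b) ⊎-dec (v ≟ c) ⊎-dec (v ≟ d)

Quad⊆ : {X : Fin n → Set} → X a → X b → X c → X d → ∀ {v} → Quad a b c d v → X v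
Quad⊆ Xa _  _  _  (inj₁ refl)                = Xa
Quad⊆ _  Xb _  _  (inj₂ (inj₁ refl))         = Xb
Quad⊆ _  _  Xc _  (inj₂ (inj₂ (inj₁ refl)))  = Xc
Quad⊆ _  _  _  Xd (inj₂ (inj₂ (inj₂ refl)))  = Xd

cycQuad-gap : CycQuad a b c d → a ≢ p → b ≢ p → c ≢ p → d ≢ p →
              Cyc3 a p b ⊎ Cyc3 b p c ⊎ Cyc3 c p d ⊎ Cyc3 d p a
cycQuad-gap (cycQuad′ abc abd acd bcd) a≢p b≢p c≢p d≢p
  with cyc3-total a≢p (≢-sym b≢p) (cyc3⇒≢₁₂ abc)
... | inj₁ apb = inj₁ apb
... | inj₂ abp with cyc3-total a≢p (≢-sym c≢p) (cyc3⇒≢₁₃ abc)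
...   | inj₁ apc = inj₂ (inj₁ (cyc3-recut abp apc))
...   | inj₂ acp with cyc3-total a≢p (≢-sym d≢p) (cyc3⇒≢₁₃ acd)
...     | inj₁ apd = inj₂ (inj₂ (inj₁ (cyc3-recut acp apd)))
...     | inj₂ adp = inj₂ (inj₂ (inj₂ (cyc3-rotate adp)))

-- If the chord {p,q} has p inside the arc (r,s) and q not inside the
-- opposite arc, then one of the two arcs cut out by {p,q} lies inside (r,s).
cyc3-catch : ∀ {r s x y} → Cyc3 r p s → ¬ Cyc3 s q r → Cyc3 p x q → Cyc3 q y p → Cyc3 r x s ⊎ Cyc3 r y s
cyc3-catch {p = p} {q} {r} {s} rps ¬sqr pxq qyp with q ≟ s | q ≟ r
... | yes refl | _        = inj₁ (cyc3-rotate (cyc3-trans (cyc3-rotate⁻¹ rps) (cyc3-rotate⁻¹ pxq)))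
... | no _     | yes refl = inj₂ (cyc3-trans qyp rps)
... | no q≢s   | no q≢r   with cyc3-total (≢-sym q≢r) q≢s (cyc3⇒≢₁₃ rps)
...   | inj₂ rsq = ⊥-elim (¬sqr (cyc3-rotate rsq))
...   | inj₁ rqs with cyc3-total (cyc3⇒≢₁₂ rps) (cyc3⇒≢₁₃ pxq) (≢-sym q≢r)
...     | inj₁ rpq = inj₁ (cyc3-trans (cyc3-rotate (cyc3-trans (cyc3-rotate⁻¹ rpq) (cyc3-rotate⁻¹ pxq))) rqs)
...     | inj₂ rqp = inj₂ (cyc3-trans (cyc3-rotate (cyc3-trans (cyc3-rotate⁻¹ rqp) (cyc3-rotate⁻¹ qyp))) rps)

-- Gluing along a diagonal

data Position {n} (a b c d : Fin n) : Fin n → Set where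
  at₁ : Position a b c d a
  at₂ : Position a b c d b
  at₃ : Position a b c d c
  at₄ : Position a b c d d
  in₁₂ : ∀ {p} → Cyc3 a p b → Position a b c d p
  in₂₃ : ∀ {p} → Cyc3 b p c → Position a b c d p
  in₃₄ : ∀ {p} → Cyc3 c p d → Position a b c d p
  in₄₁ : ∀ {p} → Cyc3 d p a → Position a b c d p

position : ∀ {a b c d : Fin n} → CycQuad a b c d → ∀ p → Position a b c d p
position {a = a} {b} {c} {d} q p with a ≟ p | b ≟ p | c ≟ p | d ≟ p
... | yes refl | _        | _        | _        = at₁
... | no _     | yes refl | _        | _        = at₂
... | no _     | no _     | yes refl | _        = at₃
... | no _     | no _     | no _     | yes refl = at₄
... | no a≢p   | no b≢p   | no c≢p   | no d≢p   with cycQuad-gap q a≢p b≢p c≢p d≢p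
...   | inj₁ apb                = in₁₂ apb
...   | inj₂ (inj₁ bpc)         = in₂₃ bpc
...   | inj₂ (inj₂ (inj₁ cpd))  = in₃₄ cpd
...   | inj₂ (inj₂ (inj₂ dpa))  = in₄₁ dpa

ClosedArc : Fin n → Fin n → Fin n → Set
ClosedArc p q v = v ≡ p ⊎ v ≡ q ⊎ Cyc3 p v q

closedArc⇒¬cyc3 : ∀ {p q v : Fin n} → ClosedArc p q v → ¬ Cyc3 q v p
closedArc⇒¬cyc3 (inj₁ refl)         qpp = cyc3⇒≢₂₃ qpp refl
closedArc⇒¬cyc3 (inj₂ (inj₁ refl))  qqp = cyc3⇒≢₁₂ qqp refl
closedArc⇒¬cyc3 (inj₂ (inj₂ pvq))   qvp = cyc3-asym (cyc3-rotate qvp) (cyc3-rotate pvq)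

quad-onArc : ∀ {p q a b c d : Fin n} → ClosedArc p q a → ClosedArc p q b → ClosedArc p q c → ClosedArc p q d →
             ∀ {v} → Quad a b c d v → ClosedArc p q v
quad-onArc = Quad⊆

OnOneSide : Fin n → Fin n → (Fin n → Set) → Set
OnOneSide p q X = (∀ {v} → X v → ClosedArc p q v) ⊎ (∀ {v} → X v → ClosedArc q p v)

module Gluing (K : Semifield) {n} (F : Fin n → Fin n → Semifield.Carrier K) (F-sym : ∀ a b → F a b ≡ F b a)
              (A : Fin n → Set) {p q : Fin n} (p≢q : p ≢ q) (Ap : A p) (Aq : A q)
              (ptolemy-across : ∀ {x y} → Cyc3 p x q → Cyc3 q y p → PtolemyRelations.Ptolemy K F F-sym p x q y)
              (ptolemy-one-side : ∀ {a b c d} → CycQuad a b c d → A a → A b → A c → A d →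
                                    OnOneSide p q (Quad a b c d) → PtolemyRelations.Ptolemy K F F-sym a b c d) where
  open PtolemyRelations K F F-sym

  ptolemy-from-p : ∀ {x y z} → CycQuad p x y z → A x → A y → A z → Ptolemy p x y z
  ptolemy-from-p {x} {y} {z} κ Ax Ay Az with position κ q
  ... | at₁ = ⊥-elim (p≢q refl)
  ... | at₂ = ptolemy-one-side κ Ap Ax Ay Az
                (inj₂ (quad-onArc (inj₂ (inj₁ refl)) (inj₁ refl) (inj₂ (inj₂ (cyc3-rotate abc))) (inj₂ (inj₂ (cyc3-rotate abd)))))
    where open CycQuad κ
  ... | at₃ = ptolemy-across (CycQuad.abc κ) (cyc3-rotate (CycQuad.acd κ))
  ... | at₄ = ptolemy-one-side κ Ap Ax Ay Az
                (inj₁ (quad-onArc (inj₁ refl) (inj₂ (inj₂ abd)) (inj₂ (inj₂ acd)) (inj₂ (inj₁ refl))))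
    where open CycQuad κ
  ... | in₁₂ pqx = ptolemy-one-side κ Ap Ax Ay Az
                (inj₂ (quad-onArc (inj₂ (inj₁ refl)) (inj₂ (inj₂ (cyc3-rotate⁻¹ ade)))
                              (inj₂ (inj₂ (cyc3-rotate⁻¹ bde))) (inj₂ (inj₂ (cyc3-rotate⁻¹ cde)))))
    where
    open CycPent (cycPent (cycQuad-rotate κ) pqx)
  ... | in₄₁ zqp = ptolemy-one-side κ Ap Ax Ay Az
                (inj₁ (quad-onArc (inj₁ refl) (inj₂ (inj₂ abe)) (inj₂ (inj₂ ace)) (inj₂ (inj₂ ade))))
    where open CycPent (cycPent κ zqp)
  ... | in₂₃ xqy = ptolemy-rotate² (ptolemy-pentagon′ (ptolemy-rotate² pxqy) (ptolemy-rotate pqyz) (ptolemy-rotate² pxqz))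
    where
    π = cycPent-rotate (cycPent-rotate (cycPent (cycQuad-rotate (cycQuad-rotate κ)) xqy))
    open CycPent π
    pxqy = ptolemy-across abc (cyc3-rotate acd)
    pxqz = ptolemy-across abc (cyc3-rotate ace)
    pqyz = ptolemy-one-side (cycPent-drop₂ π) Ap Aq Ay Az
             (inj₂ (quad-onArc (inj₂ (inj₁ refl)) (inj₁ refl) (inj₂ (inj₂ (cyc3-rotate acd))) (inj₂ (inj₂ (cyc3-rotate ace)))))
  ... | in₃₄ yqz = ptolemy-rotate (ptolemy-pentagon (ptolemy-rotate² pyqz) (ptolemy-rotate⁻¹ pxyq) (ptolemy-rotate² pxqz))
    where
    π = cycPent-rotate (cycPent (cycQuad-rotate (cycQuad-rotate (cycQuad-rotate κ))) yqz)
    open CycPent π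
    pxqz = ptolemy-across abd (cyc3-rotate ade)
    pyqz = ptolemy-across acd (cyc3-rotate ade)
    pxyq = ptolemy-one-side (cycPent-drop₅ π) Ap Ax Ay Aq
             (inj₁ (quad-onArc (inj₁ refl) (inj₂ (inj₂ abd)) (inj₂ (inj₂ acd)) (inj₂ (inj₁ refl))))

  ptolemy-avoiding-p : ∀ {a b c d} → CycQuad a b c d → Cyc3 d p a → A a → A b → A c → A d → Ptolemy a b c d
  ptolemy-avoiding-p κ dpa Aa Ab Ac Ad =
    ptolemy-pentagon (ptolemy-from-p (cycPent-drop₄ π) Aa Ab Ad) (ptolemy-from-p (cycPent-drop₂ π) Ab Ac Ad)
                     (ptolemy-from-p (cycPent-drop₅ π) Aa Ab Ac)
    where
    π = cycPent-rotate (cycPent-rotate (cycPent-rotate (cycPent-rotate (cycPent κ dpa))))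

  ptolemy-glued : ∀ {a b c d} → CycQuad a b c d → A a → A b → A c → A d → Ptolemy a b c d
  ptolemy-glued κ Aa Ab Ac Ad with position κ p
  ... | at₁ = ptolemy-from-p κ Ab Ac Ad
  ... | at₂ = ptolemy-rotate⁻¹ (ptolemy-from-p (cycQuad-rotate κ) Ac Ad Aa)
  ... | at₃ = ptolemy-rotate² (ptolemy-from-p (cycQuad-rotate (cycQuad-rotate κ)) Ad Aa Ab)
  ... | at₄ = ptolemy-rotate (ptolemy-from-p (cycQuad-rotate (cycQuad-rotate (cycQuad-rotate κ))) Aa Ab Ac)
  ... | in₁₂ apb = ptolemy-rotate⁻¹ (ptolemy-avoiding-p (cycQuad-rotate κ) apb Ab Ac Ad Aa)
  ... | in₂₃ bpc = ptolemy-rotate² (ptolemy-avoiding-p (cycQuad-rotate (cycQuad-rotate κ)) bpc Ac Ad Aa Ab)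
  ... | in₃₄ cpd = ptolemy-rotate (ptolemy-avoiding-p (cycQuad-rotate (cycQuad-rotate (cycQuad-rotate κ))) cpd Ad Aa Ab Ac)
  ... | in₄₁ dpa = ptolemy-avoiding-p κ dpa Aa Ab Ac Ad

-- Friezes as families of Ptolemy relations

onPair-sym : ∀ (x : T) (g : Diag n → T) a b → onPair x g a b ≡ onPair x g b a
onPair-sym x g a b with <-cmp a b | <-cmp b a
... | tri< a<b _ _ | tri< b<a _ _ = ⊥-elim (<-asym a<b b<a)
... | tri< a<b _ _ | tri≈ _ b≡a _ = ⊥-elim (<-irrefl (sym b≡a) a<b)
... | tri< a<b _ _ | tri> _ _ a<b′ = cong (g ∘ diag a b) (<-irrelevant a<b a<b′)
... | tri≈ _ a≡b _ | tri< b<a _ _ = ⊥-elim (<-irrefl (sym a≡b) b<a)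
... | tri≈ _ _ _   | tri≈ _ _ _   = refl
... | tri≈ _ a≡b _ | tri> _ _ a<b = ⊥-elim (<-irrefl a≡b a<b)
... | tri> _ _ b<a | tri< b<a′ _ _ = cong (g ∘ diag b a) (<-irrelevant b<a b<a′)
... | tri> _ _ b<a | tri≈ _ b≡a _ = ⊥-elim (<-irrefl b≡a b<a)
... | tri> _ _ b<a | tri> _ _ a<b = ⊥-elim (<-asym a<b b<a)

onPair-< : ∀ (x : T) (g : Diag n → T) {a b} (a<b : a < b) → onPair x g a b ≡ g (diag a b a<b)
onPair-< x g {a} {b} a<b with <-cmp a b
... | tri< a<b′ _ _ = cong (g ∘ diag a b) (<-irrelevant a<b′ a<b)
... | tri≈ _ a≡b _  = ⊥-elim (<-irrefl a≡b a<b)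
... | tri> _ _ b<a  = ⊥-elim (<-asym a<b b<a)

∈D⁺ : ∀ {D : DiagSet n} e → D e → (lo e , hi e) ∈D D
∈D⁺ {D = D} e De = subst (λ X → X) (sym (onPair-< ⊥ D (lo<hi e))) De

onPair-cong : ∀ (x : T) {g h : Diag n → T} {S : Subset n} → (∀ d → InDiag S d → g d ≡ h d) →
              ∀ {a b} → a ∈ S → b ∈ S → onPair x g a b ≡ onPair x h a b
onPair-cong x g≗h {a = a} {b} a∈S b∈S with <-cmp a b
... | tri< _ _ _ = g≗h _ (a∈S , b∈S)
... | tri≈ _ _ _ = refl
... | tri> _ _ _ = g≗h _ (b∈S , a∈S)

module FriezeProperties (K : Semifield) {n : ℕ} where
  open Semifield K
  open SemifieldProperties K

  module _ (f : Diag n → Carrier) where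
    open PtolemyRelations K (onPair 1# f) (onPair-sym 1# f) public

    ptolemyAt-swap : ∀ {α β γ δ} → PtolemyAt K f α β δ γ → PtolemyAt K f α β γ δ
    ptolemyAt-swap {α} {β} {γ} {δ} eq = begin
      F α β * F γ δ                  ≡⟨ cong (F α β *_) (onPair-sym 1# f γ δ) ⟩
      F α β * F δ γ                  ≡⟨ eq ⟩
      F α δ * F β γ + F α γ * F β δ  ≡⟨ +-comm _ _ ⟩
      F α γ * F β δ + F α δ * F β γ  ∎
      where
      open ≡-Reasoning
      F = onPair 1# f

    ptolemyAt⇒ptolemy : ∀ {a b c d} → PtolemyAt K f a c b d → Ptolemy a b c d
    ptolemyAt⇒ptolemy {a} {b} {c} {d} eq =
      trans eq (cong (λ t → onPair 1# f a b * onPair 1# f c d + onPair 1# f a d * t) (onPair-sym 1# f c b))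

    ptolemy⇒ptolemyAt : ∀ {a b c d} → Ptolemy a b c d → PtolemyAt K f a c b d
    ptolemy⇒ptolemyAt {a} {b} {c} {d} eq =
      trans eq (cong (λ t → onPair 1# f a b * onPair 1# f c d + onPair 1# f a d * t) (onPair-sym 1# f b c))

    isFriezeOn⇒ptolemy : ∀ {S : Subset n} {a b c d} → IsFriezeOn K S f →
                          CycQuad a b c d → a ∈ S → b ∈ S → c ∈ S → d ∈ S → Ptolemy a b c d
    isFriezeOn⇒ptolemy {a = a} {b} {c} {d} fr κ a∈S b∈S c∈S d∈S =
      ptolemyAt⇒ptolemy {a} {b} {c} {d} (fr a c b d a∈S c∈S b∈S d∈S (inj₁ (cycQuad⇒Cyc4 κ)))

    ptolemy⇒isFriezeOn : ∀ {S} →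
                          (∀ {a b c d} → CycQuad a b c d → a ∈ S → b ∈ S → c ∈ S → d ∈ S → Ptolemy a b c d) →
                          IsFriezeOn K S f
    ptolemy⇒isFriezeOn ptolemy α β γ δ α∈S β∈S γ∈S δ∈S (inj₁ αγβδ) =
      ptolemy⇒ptolemyAt {α} {γ} {β} {δ} (ptolemy (Cyc4⇒cycQuad αγβδ) α∈S γ∈S β∈S δ∈S)
    ptolemy⇒isFriezeOn ptolemy α β γ δ α∈S β∈S γ∈S δ∈S (inj₂ αδβγ) =
      ptolemyAt-swap {α} {β} {γ} {δ} (ptolemy⇒ptolemyAt {α} {δ} {β} {γ} (ptolemy (Cyc4⇒cycQuad αδβγ) α∈S δ∈S β∈S γ∈S))

  isFriezeOn-cong : ∀ {S : Subset n} {f g : Diag n → Carrier} → (∀ d → InDiag S d → f d ≡ g d) →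
                    IsFriezeOn K S f → IsFriezeOn K S g
  isFriezeOn-cong {S} {f} {g} f≗g fr α β γ δ α∈S β∈S γ∈S δ∈S cross = begin
    G α β * G γ δ                  ≡⟨ sym (cong₂ _*_ (f≗g′ α∈S β∈S) (f≗g′ γ∈S δ∈S)) ⟩
    F α β * F γ δ                  ≡⟨ fr α β γ δ α∈S β∈S γ∈S δ∈S cross ⟩
    F α γ * F β δ + F α δ * F β γ  ≡⟨ cong₂ _+_ (cong₂ _*_ (f≗g′ α∈S γ∈S) (f≗g′ β∈S δ∈S))
                                                (cong₂ _*_ (f≗g′ α∈S δ∈S) (f≗g′ β∈S γ∈S)) ⟩
    G α γ * G β δ + G α δ * G β γ  ∎
    where
    open ≡-Reasoning
    F = onPair 1# f
    G = onPair 1# g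
    f≗g′ : ∀ {a b} → a ∈ S → b ∈ S → F a b ≡ G a b
    f≗g′ = onPair-cong 1# f≗g

-- Diagonals splitting a quadrilateral

satisfying : {P : Fin n → Set} → (∀ x → Dec (P x)) → Subset n
satisfying P? = tabulate (does ∘ P?)

∈-satisfying⁺ : {P : Fin n → Set} (P? : ∀ x → Dec (P x)) {x : Fin n} → P x → x ∈ satisfying P?
∈-satisfying⁺ P? {x} px = lookup⇒[]= x _ (trans (lookup∘tabulate (does ∘ P?) x) (dec-true (P? x) px))

∈-satisfying⁻ : {P : Fin n → Set} (P? : ∀ x → Dec (P x)) {x : Fin n} → x ∈ satisfying P? → P x
∈-satisfying⁻ P? {x} x∈ with P? x | trans (sym (lookup∘tabulate (does ∘ P?) x)) ([]=⇒lookup x∈)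
... | yes px | _ = px
... | no _   | ()

module Separation {n m : ℕ} (ds : Fin m → Diag n) (noncrossing : ∀ k l → ¬ CrossD (ds k) (ds l)) where

  P Q : Fin m → Fin n
  P k = lo (ds k)
  Q k = hi (ds k)

  Separates : Fin m → Fin n → Fin n → Set
  Separates k u v = Cyc3 (P k) u (Q k) × Cyc3 (Q k) v (P k)

  Splits : Fin m → (Fin n → Set) → Set
  Splits k X = Σ (Fin n) λ u → Σ (Fin n) λ v → X u × X v × Separates k u v

  splits? : {X : Fin n → Set} → (∀ v → Dec (X v)) → ∀ k → Dec (Splits k X)
  splits? X? k = any? λ u → any? λ v → X? u ×-dec X? v ×-dec cyc3? _ _ _ ×-dec cyc3? _ _ _

  splits-mono : ∀ {k} {X Y : Fin n → Set} → (∀ {v} → X v → Y v) → Splits k X → Splits k Y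
  splits-mono X⊆Y (u , v , Xu , Xv , sep) = u , v , X⊆Y Xu , X⊆Y Xv , sep

  ¬separates-ends : ∀ j k → ¬ Separates j (P k) (Q k)
  ¬separates-ends j k (pj-pk-qj , qj-qk-pj) =
    noncrossing j k (inj₁ (cycQuad⇒Cyc4 (cycQuad pj-pk-qj (cyc3-rotate⁻¹ qj-qk-pj))))

  ¬separates-ends′ : ∀ j k → ¬ Separates j (Q k) (P k)
  ¬separates-ends′ j k (pj-qk-qj , qj-pk-pj) =
    noncrossing j k (inj₂ (cycQuad⇒Cyc4 (cycQuad pj-qk-qj (cyc3-rotate⁻¹ qj-pk-pj))))

  WithEnds : Fin m → (Fin n → Set) → Fin n → Set
  WithEnds k X v = X v ⊎ v ≡ P k ⊎ v ≡ Q k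

  -- Since d_j and d_k do not cross, an endpoint of d_k on one side of d_j
  -- can be traded for a point of X that d_k separates from another.
  splits-WithEnds : ∀ {j k X} → Splits k X → Splits j (WithEnds k X) → Splits j X
  splits-WithEnds {j} {k} {X} (x , y , Xx , Xy , pxq , qyp) (u , v , Wu , Wv , rus , svr) = go Wu Wv rus svr
    where
    within : ∀ {r s} → Cyc3 r x s ⊎ Cyc3 r y s → ∃ λ w → X w × Cyc3 r w s
    within (inj₁ rxs) = x , Xx , rxs
    within (inj₂ rys) = y , Xy , rys

    go : ∀ {u v} → WithEnds k X u → WithEnds k X v → Cyc3 (P j) u (Q j) → Cyc3 (Q j) v (P j) → Splits j X
    go (inj₁ Xu) (inj₁ Xv) rus svr = _ , _ , Xu , Xv , rus , svr
    go (inj₁ Xu) (inj₂ (inj₁ refl)) rus spr with within (cyc3-catch spr (λ rqs → ¬separates-ends′ j k (rqs , spr)) pxq qyp)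
    ... | w , Xw , swr = _ , w , Xu , Xw , rus , swr
    go (inj₁ Xu) (inj₂ (inj₂ refl)) rus sqr with within (swap (cyc3-catch sqr (λ rps → ¬separates-ends j k (rps , sqr)) qyp pxq))
    ... | w , Xw , swr = _ , w , Xu , Xw , rus , swr
    go (inj₂ (inj₁ refl)) (inj₁ Xv) rps svr with within (cyc3-catch rps (λ sqr → ¬separates-ends j k (rps , sqr)) pxq qyp)
    ... | w , Xw , rws = w , _ , Xw , Xv , rws , svr
    go (inj₂ (inj₂ refl)) (inj₁ Xv) rqs svr with within (swap (cyc3-catch rqs (λ spr → ¬separates-ends′ j k (rqs , spr)) qyp pxq))
    ... | w , Xw , rws = w , _ , Xw , Xv , rws , svr
    go (inj₂ (inj₁ refl)) (inj₂ (inj₁ refl)) rps spr = ⊥-elim (cyc3-asym (cyc3-rotate rps) (cyc3-rotate spr))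
    go (inj₂ (inj₁ refl)) (inj₂ (inj₂ refl)) rps sqr = ⊥-elim (¬separates-ends j k (rps , sqr))
    go (inj₂ (inj₂ refl)) (inj₂ (inj₁ refl)) rqs spr = ⊥-elim (¬separates-ends′ j k (rqs , spr))
    go (inj₂ (inj₂ refl)) (inj₂ (inj₂ refl)) rqs sqr = ⊥-elim (cyc3-asym (cyc3-rotate rqs) (cyc3-rotate sqr))

  onOneSide⇒¬splits : ∀ {k X} → OnOneSide (P k) (Q k) X → ¬ Splits k X
  onOneSide⇒¬splits (inj₁ X⊆pq) (_ , v , _ , Xv , _ , qvp) = closedArc⇒¬cyc3 (X⊆pq Xv) qvp
  onOneSide⇒¬splits (inj₂ X⊆qp) (u , _ , Xu , _ , puq , _) = closedArc⇒¬cyc3 (X⊆qp Xu) puq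

  splitters : Fin n → Fin n → Fin n → Fin n → Subset m
  splitters a b c d = satisfying (splits? (quad? a b c d))

  splitters-⊂ : ∀ {k a b c d a′ b′ c′ d′} → Splits k (Quad a b c d) →
    (∀ {v} → Quad a′ b′ c′ d′ v → WithEnds k (Quad a b c d) v) → ¬ Splits k (Quad a′ b′ c′ d′) →
    splitters a′ b′ c′ d′ ⊂ splitters a b c d
  splitters-⊂ {k} {a} {b} {c} {d} {a′} {b′} {c′} {d′} splits X′⊆ ¬splits′ =
    (λ {j} j∈ → ∈-satisfying⁺ (splits? (quad? a b c d)) (splits-WithEnds splits
                   (splits-mono X′⊆ (∈-satisfying⁻ (splits? (quad? a′ b′ c′ d′)) j∈)))) ,
    k , ∈-satisfying⁺ (splits? (quad? a b c d)) splits , ¬splits′ ∘ ∈-satisfying⁻ (splits? (quad? a′ b′ c′ d′))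

  -- Induction on the number of diagonals splitting the quadrilateral: gluing
  -- along one of them leaves only quadrilaterals split by strictly fewer.
  module Induction (K : Semifield) (F : Fin n → Fin n → Semifield.Carrier K) (F-sym : ∀ a b → F a b ≡ F b a)
    (ptolemy-across : ∀ k {x y} → Cyc3 (P k) x (Q k) → Cyc3 (Q k) y (P k) →
                      PtolemyRelations.Ptolemy K F F-sym (P k) x (Q k) y)
    (ptolemy-unsplit : ∀ {a b c d} → CycQuad a b c d → (∀ k → ¬ Splits k (Quad a b c d)) →
                       PtolemyRelations.Ptolemy K F F-sym a b c d) where
    open PtolemyRelations K F F-sym

    ptolemy-bounded : ∀ N {a b c d} → CycQuad a b c d → ∣ splitters a b c d ∣ ℕ.< N → Ptolemy a b c d
    ptolemy-bounded (suc N) {a} {b} {c} {d} κ bound with any? (splits? (quad? a b c d))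
    ... | no ¬split = ptolemy-unsplit κ (λ k split → ¬split (k , split))
    ... | yes (k , split) =
      Gluing.ptolemy-glued K F F-sym (WithEnds k (Quad a b c d)) (P≢Q k) (inj₂ (inj₁ refl)) (inj₂ (inj₂ refl))
        (ptolemy-across k) one-side κ (inj₁ (inj₁ refl)) (inj₁ (inj₂ (inj₁ refl)))
        (inj₁ (inj₂ (inj₂ (inj₁ refl)))) (inj₁ (inj₂ (inj₂ (inj₂ refl))))
      where
      P≢Q : ∀ k → P k ≢ Q k
      P≢Q k P≡Q = <-irrefl P≡Q (lo<hi (ds k))
      A = WithEnds k (Quad a b c d)
      one-side : ∀ {a′ b′ c′ d′} → CycQuad a′ b′ c′ d′ → A a′ → A b′ → A c′ → A d′ →
                 OnOneSide (P k) (Q k) (Quad a′ b′ c′ d′) → Ptolemy a′ b′ c′ d′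
      one-side κ′ Wa Wb Wc Wd side = ptolemy-bounded N κ′ (ℕ.<-≤-trans fewer (ℕ.≤-pred bound))
        where
        fewer = p⊂q⇒∣p∣<∣q∣ (splitters-⊂ split (Quad⊆ Wa Wb Wc Wd) (onOneSide⇒¬splits side))

    ptolemy-all : ∀ {a b c d} → CycQuad a b c d → Ptolemy a b c d
    ptolemy-all κ = ptolemy-bounded _ κ ℕ.≤-refl

-- The cell of a quadrilateral split by no diagonal

argmax-satisfying : {W : Fin m → Set} → (∀ k → Dec (W k)) → (μ : Fin m → ℕ) → Σ (Fin m) W →
                    Σ (Fin m) λ k → W k × (∀ j → W j → μ j ≤ μ k)
argmax-satisfying {m} W? μ (k₀ , Wk₀) =
  argmax μ k₀ ks , argmax-all μ Wk₀ (all-filter W? (allFin m)) ,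
  λ j Wj → All.lookup (f[xs]≤f[argmax] k₀ ks) (∈-filter⁺ W? (∈-allFin j) Wj)
  where ks = filter W? (allFin m)

argmin-satisfying : {W : Fin m → Set} → (∀ k → Dec (W k)) → (μ : Fin m → ℕ) → Σ (Fin m) W →
                    Σ (Fin m) λ k → W k × (∀ j → W j → μ k ≤ μ j)
argmin-satisfying {m} W? μ (k₀ , Wk₀) =
  argmin μ k₀ ks , argmin-all μ Wk₀ (all-filter W? (allFin m)) ,
  λ j Wj → All.lookup (f[argmin]≤f[xs] k₀ ks) (∈-filter⁺ W? (∈-allFin j) Wj)
  where ks = filter W? (allFin m)

∸-<-widenˡ : ∀ {a′ a b b′} → a′ ℕ.< a → a ℕ.< b → b ≤ b′ → b ∸ a ℕ.< b′ ∸ a′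
∸-<-widenˡ {a′} a′<a a<b b≤b′ = ℕ.<-≤-trans (ℕ.∸-monoʳ-< a′<a (ℕ.<⇒≤ a<b)) (ℕ.∸-monoˡ-≤ a′ b≤b′)

∸-<-widenʳ : ∀ {a′ a b b′} → a′ ≤ a → a ℕ.< b → b ℕ.< b′ → b ∸ a ℕ.< b′ ∸ a′
∸-<-widenʳ {b′ = b′} a′≤a a<b b<b′ = ℕ.<-≤-trans (ℕ.∸-monoˡ-< b<b′ (ℕ.<⇒≤ a<b)) (ℕ.∸-monoʳ-≤ b′ a′≤a)

three-elements⇒3≤∣p∣ : ∀ {p : Subset n} {a b c} → a ∈ p → b ∈ p → c ∈ p → a ≢ b → a ≢ c → b ≢ c → 3 ≤ ∣ p ∣
three-elements⇒3≤∣p∣ {p = p} {a} {b} {c} a∈p b∈p c∈p a≢b a≢c b≢c =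
  ℕ.≤-trans (s≤s (ℕ.≤-trans (s≤s (ℕ.≤-trans (s≤s z≤n) (x∈p⇒∣p-x∣<∣p∣ c∈p-a-b))) (x∈p⇒∣p-x∣<∣p∣ b∈p-a)))
            (x∈p⇒∣p-x∣<∣p∣ a∈p)
  where
  b∈p-a : b ∈ p - a
  b∈p-a = x∈p∧x∉q⇒x∈p─q b∈p (x≢y⇒x∉⁅y⁆ (≢-sym a≢b))
  c∈p-a-b : c ∈ p - a - b
  c∈p-a-b = x∈p∧x∉q⇒x∈p─q (x∈p∧x∉q⇒x∈p─q c∈p (x≢y⇒x∉⁅y⁆ (≢-sym a≢c))) (x≢y⇒x∉⁅y⁆ (≢-sym b≢c))

avoiding : ∀ {a b c : Fin n} p q → a ≢ b → a ≢ c → b ≢ c →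
           ∃ λ v → (v ≡ a ⊎ v ≡ b ⊎ v ≡ c) × v ≢ p × v ≢ q
avoiding {a = a} {b} {c} p q a≢b a≢c b≢c with a ≟ p | a ≟ q
... | no a≢p   | no a≢q   = a , inj₁ refl , a≢p , a≢q
... | yes refl | _        with b ≟ q
...   | no b≢q   = b , inj₂ (inj₁ refl) , ≢-sym a≢b , b≢q
...   | yes refl = c , inj₂ (inj₂ refl) , ≢-sym a≢c , ≢-sym b≢c
avoiding {a = a} {b} {c} p q a≢b a≢c b≢c | no _ | yes refl with b ≟ p
...   | no b≢p   = b , inj₂ (inj₁ refl) , b≢p , ≢-sym a≢b
...   | yes refl = c , inj₂ (inj₂ refl) , ≢-sym b≢c , ≢-sym a≢c

least-vertex : Fin n → Σ (Fin n) λ z → ∀ (x : Fin n) → z Fin.≤ x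
least-vertex {suc _} _ = Fin.zero , λ _ → z≤n

greatest-vertex : Fin n → Σ (Fin n) λ z → ∀ (x : Fin n) → x Fin.≤ z
greatest-vertex {suc n} _ = fromℕ n , ≤fromℕ

diag-≡ : ∀ {e : Diag n} {u w} {u<w : u < w} → lo e ≡ u → hi e ≡ w → e ≡ diag u w u<w
diag-≡ {e = diag _ _ lo<hi} refl refl = cong (diag _ _) (<-irrelevant lo<hi _)

module Cell {n m : ℕ} (ds : Fin m → Diag n) (noncrossing : ∀ k l → ¬ CrossD (ds k) (ds l))
            {a b c d : Fin n} (κ : CycQuad a b c d) (unsplit : ∀ k → ¬ Separation.Splits ds noncrossing k (Quad a b c d)) where
  open Separation ds noncrossing

  Diagonal : Diag n → Set
  Diagonal e = Σ (Fin m) λ k → ds k ≡ e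

  SeparatedFrom : Fin m → Fin n → Set
  SeparatedFrom k v = Σ (Fin n) λ x → Quad a b c d x × (Separates k v x ⊎ Separates k x v)

  separatedFrom? : ∀ k v → Dec (SeparatedFrom k v)
  separatedFrom? k v = any? λ x → quad? a b c d x ×-dec
    ((cyc3? _ _ _ ×-dec cyc3? _ _ _) ⊎-dec (cyc3? _ _ _ ×-dec cyc3? _ _ _))

  Unseparated : Fin n → Set
  Unseparated v = ∀ k → ¬ SeparatedFrom k v

  unseparated? : ∀ v → Dec (Unseparated v)
  unseparated? v = all? λ k → ¬? (separatedFrom? k v)

  S : Subset n
  S = satisfying unseparated?

  separated-somewhere : ∀ {v} → v ∉ S → ∃ λ k → SeparatedFrom k v
  separated-somewhere {v} v∉S with any? (λ k → separatedFrom? k v)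
  ... | yes sep = sep
  ... | no ¬sep = ⊥-elim (v∉S (∈-satisfying⁺ unseparated? (λ k sep → ¬sep (k , sep))))

  quad⊆S : ∀ {v} → Quad a b c d v → v ∈ S
  quad⊆S Xv = ∈-satisfying⁺ unseparated? λ where
    k (x , Xx , inj₁ sep) → unsplit k (_ , x , Xv , Xx , sep)
    k (x , Xx , inj₂ sep) → unsplit k (x , _ , Xx , Xv , sep)

  Inside : Fin m → Fin n → Set
  Inside k v = P k < v × v < Q k

  Outside : Fin m → Fin n → Set
  Outside k v = v < P k ⊎ Q k < v

  cyc3⇒inside : ∀ {k v} → Cyc3 (P k) v (Q k) → Inside k v
  cyc3⇒inside (inj₁ pvq)                  = pvq
  cyc3⇒inside {k} (inj₂ (inj₁ (_ , q<p))) = ⊥-elim (ℕ.<-asym (lo<hi (ds k)) q<p)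
  cyc3⇒inside {k} (inj₂ (inj₂ (q<p , _))) = ⊥-elim (ℕ.<-asym (lo<hi (ds k)) q<p)

  cyc3⇒outside : ∀ {k v} → Cyc3 (Q k) v (P k) → Outside k v
  cyc3⇒outside {k} (inj₁ (q<v , v<p)) = ⊥-elim (ℕ.<-asym (lo<hi (ds k)) (ℕ.<-trans q<v v<p))
  cyc3⇒outside (inj₂ (inj₁ (v<p , _)))  = inj₁ v<p
  cyc3⇒outside (inj₂ (inj₂ (_ , q<v)))  = inj₂ q<v

  outside⇒cyc3 : ∀ {k v} → Outside k v → Cyc3 (Q k) v (P k)
  outside⇒cyc3 {k} (inj₁ v<p) = inj₂ (inj₁ (v<p , lo<hi (ds k)))
  outside⇒cyc3 {k} (inj₂ q<v) = inj₂ (inj₂ (lo<hi (ds k) , q<v))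

  in-S⇒¬inside : ∀ {k v x} → v ∈ S → Quad a b c d x → Outside k x → ¬ Inside k v
  in-S⇒¬inside v∈S Xx x-out v-in =
    ∈-satisfying⁻ unseparated? v∈S _ (_ , Xx , inj₁ (inj₁ v-in , outside⇒cyc3 x-out))

  in-S⇒¬outside : ∀ {k v x} → v ∈ S → Quad a b c d x → Inside k x → ¬ Outside k v
  in-S⇒¬outside v∈S Xx x-in v-out =
    ∈-satisfying⁻ unseparated? v∈S _ (_ , Xx , inj₂ (inj₁ x-in , outside⇒cyc3 v-out))

  separated-side : ∀ {k v} → SeparatedFrom k v →
    (Inside k v × ∀ {u} → u ∈ S → ¬ Inside k u) ⊎ (Outside k v × ∀ {u} → u ∈ S → ¬ Outside k u)
  separated-side (x , Xx , inj₁ (pvq , qxp)) = inj₁ (cyc3⇒inside pvq , λ u∈S → in-S⇒¬inside u∈S Xx (cyc3⇒outside qxp))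
  separated-side (x , Xx , inj₂ (pxq , qvp)) = inj₂ (cyc3⇒outside qvp , λ u∈S → in-S⇒¬outside u∈S Xx (cyc3⇒inside pxq))

  ¬inside⇒≤P : ∀ {k u} → ¬ Inside k u → u < Q k → u Fin.≤ P k
  ¬inside⇒≤P ¬in u<q = ℕ.≮⇒≥ λ p<u → ¬in (p<u , u<q)

  ¬inside⇒Q≤ : ∀ {k u} → ¬ Inside k u → P k < u → Q k Fin.≤ u
  ¬inside⇒Q≤ ¬in p<u = ℕ.≮⇒≥ λ u<q → ¬in (p<u , u<q)

  ¬outside⇒P≤ : ∀ {k u} → ¬ Outside k u → P k Fin.≤ u
  ¬outside⇒P≤ ¬out = ℕ.≮⇒≥ λ u<p → ¬out (inj₁ u<p)

  ¬outside⇒≤Q : ∀ {k u} → ¬ Outside k u → u Fin.≤ Q k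
  ¬outside⇒≤Q ¬out = ℕ.≮⇒≥ λ q<u → ¬out (inj₂ q<u)

  span : Fin m → ℕ
  span k = toℕ (Q k) ∸ toℕ (P k)

  ¬interleaved : ∀ j k → P j < P k → P k < Q j → ¬ Q j < Q k
  ¬interleaved j k pj<pk pk<qj qj<qk = noncrossing j k (inj₁ (inj₁ (pj<pk , pk<qj , qj<qk)))


  module InnerEdge {u w : Fin n} (u<w : u < w) (u∈S : u ∈ S) (w∈S : w ∈ S)
                   (no-between : ∀ c → c ∈ S → ¬ (u < c × c < w)) where
    Nested : Fin m → Set
    Nested k = u Fin.≤ P k × Q k Fin.≤ w

    nested? : ∀ k → Dec (Nested k)
    nested? k = (u ≤? P k) ×-dec (Q k ≤? w)

    between⇒nested : ∀ {c} → u < c → c < w → ∃ λ j → Nested j × Inside j c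
    between⇒nested {c} u<c c<w with separated-somewhere (λ c∈S → no-between c c∈S (u<c , c<w))
    ... | j , sep with separated-side sep
    ...   | inj₁ (c-in , ¬in) =
            j , (¬inside⇒≤P (¬in u∈S) (ℕ.<-trans u<c (proj₂ c-in)) , ¬inside⇒Q≤ (¬in w∈S) (ℕ.<-trans (proj₁ c-in) c<w)) , c-in
    ...   | inj₂ (inj₁ c<p , ¬out) = ⊥-elim (ℕ.<-asym (ℕ.<-≤-trans c<p (¬outside⇒P≤ (¬out u∈S))) u<c)
    ...   | inj₂ (inj₂ q<c , ¬out) = ⊥-elim (ℕ.<-asym (ℕ.<-≤-trans c<w (¬outside⇒≤Q (¬out w∈S))) q<c)

    module Widest (k : Fin m) (nested : Nested k) (widest : ∀ j → Nested j → span j ≤ span k) where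
      u≤P : u Fin.≤ P k
      u≤P = proj₁ nested

      Q≤w : Q k Fin.≤ w
      Q≤w = proj₂ nested

      ¬u<P : ¬ u < P k
      ¬u<P u<p with between⇒nested u<p (ℕ.<-≤-trans (lo<hi (ds k)) Q≤w)
      ... | j , nested-j , (pj<pk , pk<qj) =
        ℕ.<⇒≱ (∸-<-widenˡ pj<pk (lo<hi (ds k)) (ℕ.≮⇒≥ (¬interleaved j k pj<pk pk<qj))) (widest j nested-j)

      ¬Q<w : ¬ Q k < w
      ¬Q<w q<w with between⇒nested (ℕ.≤-<-trans u≤P (lo<hi (ds k))) q<w
      ... | j , nested-j , (pj<qk , qk<qj) =
        ℕ.<⇒≱ (∸-<-widenʳ (ℕ.≮⇒≥ λ pk<pj → ¬interleaved k j pk<pj pj<qk qk<qj) (lo<hi (ds k)) qk<qj) (widest j nested-j)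

      diagonal : Diagonal (diag u w u<w)
      diagonal = k , diag-≡ (≤-antisym (ℕ.≮⇒≥ ¬u<P) u≤P) (≤-antisym Q≤w (ℕ.≮⇒≥ ¬Q<w))

    edge-or-diagonal : IsEdgeOf ⊤ (diag u w u<w) ⊎ Diagonal (diag u w u<w)
    edge-or-diagonal with any? (λ c → (u <? c) ×-dec (c <? w))
    ... | no ¬between = inj₁ (inj₁ λ c _ between → ¬between (c , between))
    ... | yes (c , u<c , c<w) with between⇒nested u<c c<w
    ...   | j , nested-j , _ with argmax-satisfying nested? span (j , nested-j)
    ...     | k , nested-k , widest = inj₂ (Widest.diagonal k nested-k widest)

  module OuterEdge {u w : Fin n} (u<w : u < w) (u∈S : u ∈ S) (w∈S : w ∈ S)
                   (no-beyond : ∀ c → c ∈ S → ¬ c < u × ¬ w < c) where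
    Enclosing : Fin m → Set
    Enclosing k = P k Fin.≤ u × w Fin.≤ Q k

    enclosing? : ∀ k → Dec (Enclosing k)
    enclosing? k = (P k ≤? u) ×-dec (w ≤? Q k)

    enclosing : ∀ {j} → (∀ {v} → v ∈ S → ¬ Outside j v) → Enclosing j
    enclosing ¬out = ¬outside⇒P≤ (¬out u∈S) , ¬outside⇒≤Q (¬out w∈S)

    extreme⇒enclosing : ∀ {z} → z ∉ S → (∀ j → ¬ Inside j z) → ∃ Enclosing
    extreme⇒enclosing z∉S ¬in with separated-somewhere z∉S
    ... | j , sep with separated-side sep
    ...   | inj₁ (z-in , _) = ⊥-elim (¬in j z-in)
    ...   | inj₂ (_ , ¬out) = j , enclosing ¬out

    beyond⇒enclosing : ∀ {c} → c < u ⊎ w < c → ∃ Enclosing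
    beyond⇒enclosing {c} (inj₁ c<u) with least-vertex c
    ... | z , least = extreme⇒enclosing (λ z∈S → proj₁ (no-beyond z z∈S) (ℕ.≤-<-trans (least c) c<u))
                                        (λ j j-in → ℕ.<⇒≱ (proj₁ j-in) (least (P j)))
    beyond⇒enclosing {c} (inj₂ w<c) with greatest-vertex c
    ... | z , greatest = extreme⇒enclosing (λ z∈S → proj₂ (no-beyond z z∈S) (ℕ.<-≤-trans w<c (greatest c)))
                                           (λ j j-in → ℕ.<⇒≱ (proj₂ j-in) (greatest (Q j)))

    module Narrowest (k : Fin m) (enclosing-k : Enclosing k) (narrowest : ∀ j → Enclosing j → span k ≤ span j) where
      P≤u : P k Fin.≤ u
      P≤u = proj₁ enclosing-k

      w≤Q : w Fin.≤ Q k
      w≤Q = proj₂ enclosing-k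

      ¬P<u : ¬ P k < u
      ¬P<u pk<u with separated-somewhere (λ pk∈S → proj₁ (no-beyond (P k) pk∈S) pk<u)
      ... | j , sep with separated-side sep
      ...   | inj₁ ((pj<pk , pk<qj) , ¬in) =
              ¬interleaved j k pj<pk pk<qj (ℕ.≤-<-trans (¬inside⇒Q≤ (¬in u∈S) (ℕ.<-trans pj<pk pk<u)) (ℕ.<-≤-trans u<w w≤Q))
      ...   | inj₂ (inj₁ pk<pj , ¬out) =
              ℕ.<⇒≱ (∸-<-widenˡ pk<pj (lo<hi (ds j)) (ℕ.≮⇒≥ (¬interleaved k j pk<pj pj<qk))) (narrowest j (enclosing ¬out))
        where pj<qk = ℕ.≤-<-trans (¬outside⇒P≤ (¬out u∈S)) (ℕ.<-≤-trans u<w w≤Q)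
      ...   | inj₂ (inj₂ qj<pk , ¬out) = ℕ.<⇒≱ (ℕ.<-trans qj<pk (ℕ.<-trans pk<u u<w)) (¬outside⇒≤Q (¬out w∈S))

      ¬w<Q : ¬ w < Q k
      ¬w<Q w<qk with separated-somewhere (λ qk∈S → proj₂ (no-beyond (Q k) qk∈S) w<qk)
      ... | j , sep with separated-side sep
      ...   | inj₁ ((pj<qk , qk<qj) , ¬in) =
              ¬interleaved k j (ℕ.<-≤-trans (ℕ.≤-<-trans P≤u u<w) (¬inside⇒≤P (¬in w∈S) (ℕ.<-trans w<qk qk<qj))) pj<qk qk<qj
      ...   | inj₂ (inj₁ qk<pj , ¬out) = ℕ.<⇒≱ (ℕ.<-trans u<w (ℕ.<-trans w<qk qk<pj)) (¬outside⇒P≤ (¬out u∈S))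
      ...   | inj₂ (inj₂ qj<qk , ¬out) =
              ℕ.<⇒≱ (∸-<-widenʳ (ℕ.≮⇒≥ λ pj<pk → ¬interleaved j k pj<pk pk<qj qj<qk) (lo<hi (ds j)) qj<qk)
                    (narrowest j (enclosing ¬out))
        where pk<qj = ℕ.<-≤-trans (ℕ.≤-<-trans P≤u u<w) (¬outside⇒≤Q (¬out w∈S))

      diagonal : Diagonal (diag u w u<w)
      diagonal = k , diag-≡ (≤-antisym P≤u (ℕ.≮⇒≥ ¬P<u)) (≤-antisym (ℕ.≮⇒≥ ¬w<Q) w≤Q)

    edge-or-diagonal : IsEdgeOf ⊤ (diag u w u<w) ⊎ Diagonal (diag u w u<w)
    edge-or-diagonal with any? (λ c → (c <? u) ⊎-dec (w <? c))
    ... | no ¬beyond = inj₁ (inj₂ λ c _ → (λ c<u → ¬beyond (c , inj₁ c<u)) , (λ w<c → ¬beyond (c , inj₂ w<c)))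
    ... | yes (c , beyond) with beyond⇒enclosing beyond
    ...   | j , enclosing-j with argmin-satisfying enclosing? span (j , enclosing-j)
    ...     | k , enclosing-k , narrowest = inj₂ (Narrowest.diagonal k enclosing-k narrowest)

  edge-beside : ∀ {k x} → Quad a b c d x → x ≢ P k → x ≢ Q k → IsEdgeOf S (ds k)
  edge-beside {k} {x} Xx x≢p x≢q with <-cmp x (P k)
  ... | tri≈ _ x≡p _ = ⊥-elim (x≢p x≡p)
  ... | tri< x<p _ _ = inj₁ λ v v∈S → in-S⇒¬inside v∈S Xx (inj₁ x<p)
  ... | tri> _ _ p<x with <-cmp x (Q k)
  ...   | tri≈ _ x≡q _ = ⊥-elim (x≢q x≡q)
  ...   | tri> _ _ q<x = inj₁ λ v v∈S → in-S⇒¬inside v∈S Xx (inj₂ q<x)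
  ...   | tri< x<q _ _ = inj₂ λ v v∈S → (λ v<p → in-S⇒¬outside v∈S Xx (p<x , x<q) (inj₁ v<p))
                                      , (λ q<v → in-S⇒¬outside v∈S Xx (p<x , x<q) (inj₂ q<v))

  diagonal-edge : ∀ k → IsEdgeOf S (ds k)
  diagonal-edge k with avoiding (P k) (Q k) (cyc3⇒≢₁₂ abc) (cyc3⇒≢₁₃ abc) (cyc3⇒≢₂₃ abc)
    where open CycQuad κ
  ... | x , inj₁ x≡a , x≢p , x≢q                = edge-beside (inj₁ x≡a) x≢p x≢q
  ... | x , inj₂ (inj₁ x≡b) , x≢p , x≢q         = edge-beside (inj₂ (inj₁ x≡b)) x≢p x≢q
  ... | x , inj₂ (inj₂ x≡c) , x≢p , x≢q         = edge-beside (inj₂ (inj₂ (inj₁ x≡c))) x≢p x≢q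

  isCell : IsCellOf Diagonal S
  isCell = size , edges , λ e (_ , ¬edge) (k , dk≡e) → ¬edge (subst (IsEdgeOf S) dk≡e (diagonal-edge k))
    where
    open CycQuad κ
    size : Subpolygon S
    size = three-elements⇒3≤∣p∣ (quad⊆S (inj₁ refl)) (quad⊆S (inj₂ (inj₁ refl))) (quad⊆S (inj₂ (inj₂ (inj₁ refl))))
                                (cyc3⇒≢₁₂ abc) (cyc3⇒≢₁₃ abc) (cyc3⇒≢₂₃ abc)
    edges : ∀ e → InDiag S e → IsEdgeOf S e → IsEdgeOf ⊤ e ⊎ Diagonal e
    edges (diag u w u<w) (u∈S , w∈S) (inj₁ no-between) = InnerEdge.edge-or-diagonal u<w u∈S w∈S no-between
    edges (diag u w u<w) (u∈S , w∈S) (inj₂ no-beyond)  = OuterEdge.edge-or-diagonal u<w u∈S w∈S no-beyond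

theoremC : (K : Semifield) → (n : ℕ) → 3 ≤ n →
    (m : ℕ) (ds : Fin m → Diag n) → Injective _≡_ _≡_ ds →
    (∀ k → IsInternalOf ⊤ (ds k)) →
    (∀ k l → ¬ CrossD (ds k) (ds l)) →
    (Ps : Fin (suc m) → Subset n) → Injective _≡_ _≡_ Ps →
    (∀ i → IsCellOf (λ d → Σ (Fin m) (λ k → ds k ≡ d)) (Ps i)) →
    (∀ S → IsCellOf (λ d → Σ (Fin m) (λ k → ds k ≡ d)) S → Σ (Fin (suc m)) (λ i → Ps i ≡ S)) →
    (Ds : Fin (suc m) → DiagSet n) → (∀ i → IsDissectionOf (Ps i) (Ds i)) →
    (fs : Fin (suc m) → Diag n → Semifield.Carrier K) →
    (∀ i → IsWeakFriezeOn K (Ps i) (Ds i) (fs i)) →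
    (∀ i j d → InDiag (Ps i) d → InDiag (Ps j) d → fs i d ≡ fs j d) →
    (f : Diag n → Semifield.Carrier K) →
    IsWeakFriezeOn K ⊤ (λ d → Σ (Fin m) (λ k → ds k ≡ d) ⊎ Σ (Fin (suc m)) (λ i → Ds i d)) f →
    (∀ i d → InDiag (Ps i) d → f d ≡ fs i d) →
    (IsFriezeOn K ⊤ f ⇔ (∀ i → IsFriezeOn K (Ps i) (fs i)))
theoremC K _ _ _ ds _ _ noncrossing Ps _ _ cells _ _ fs _ _ f weak agree = mk⇔ restrict glue
  where
  open Separation ds noncrossing
  open FriezeProperties K
  open Semifield K using (1#)

  restrict : IsFriezeOn K ⊤ f → ∀ i → IsFriezeOn K (Ps i) (fs i)
  restrict frieze i = isFriezeOn-cong (agree i) λ α β γ δ _ _ _ _ → frieze α β γ δ ∈⊤ ∈⊤ ∈⊤ ∈⊤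

  across : ∀ k {x y} → Cyc3 (P k) x (Q k) → Cyc3 (Q k) y (P k) → Ptolemy f (P k) x (Q k) y
  across k {x} {y} pxq qyp =
    ptolemy-rotate² f {Q k} {y} {P k} {x} (ptolemy-reverse f {x} {P k} {y} {Q k} (ptolemyAt⇒ptolemy f {x} {P k} {y} {Q k}
    (weak x y (P k) (Q k) ∈⊤ ∈⊤ ∈⊤ ∈⊤ (inj₂ (cycQuad⇒Cyc4 (cycQuad-rotate (cycQuad pxq (cyc3-rotate⁻¹ qyp)))))
          (∈D⁺ (ds k) (inj₁ (k , refl))))))

  glue : (∀ i → IsFriezeOn K (Ps i) (fs i)) → IsFriezeOn K ⊤ f
  glue friezes = ptolemy⇒isFriezeOn f λ κ _ _ _ _ → Induction.ptolemy-all K (onPair 1# f) (onPair-sym 1# f) across unsplit κ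
    where
    unsplit : ∀ {a b c d} → CycQuad a b c d → (∀ k → ¬ Splits k (Quad a b c d)) → Ptolemy f a b c d
    unsplit {a} {b} {c} {d} κ ¬split with cells _ (Cell.isCell ds noncrossing κ ¬split)
    ... | i , Ps≡S = isFriezeOn⇒ptolemy f (isFriezeOn-cong (λ e e∈ → sym (agree i e e∈)) (friezes i)) κ
                       (∈Ps (inj₁ refl)) (∈Ps (inj₂ (inj₁ refl))) (∈Ps (inj₂ (inj₂ (inj₁ refl)))) (∈Ps (inj₂ (inj₂ (inj₂ refl))))
      where
      ∈Ps : ∀ {v} → Quad a b c d v → v ∈ Ps i
      ∈Ps Xv = subst (_ ∈_) (sym Ps≡S) (Cell.quad⊆S ds noncrossing κ ¬split Xv)
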